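{- For every modal formula $A$ the following are equivalent: (i) $\mathbf{IL}^-(\mathbf{J2}_+,\mathbf{J5})\vdash A$; (ii) $A$ is valid in all simplified $\mathbf{IL}^-(\mathbf{J2}_+,\mathbf{J5})$-frames.
   Context: Modal formulas are built from propositional variables, $\top,\bot$, connectives $\to,\lor,\land$, the unary modality $\Box$ and the binary modality $\rhd$; $\Diamond A:=\neg\Box\neg A$. The logic $\mathbf{IL}^-$ has as axioms: all tautologies; $\Box(A\to B)\to(\Box A\to\Box B)$; $\Box(\Box A\to A)\to\Box A$; $\mathbf{J3}$: $(A\rhd C)\land(B\rhd C)\to(A\lor B)\rhd C$; $\mathbf{J6}$: $\Box\neg A\leftrightarrow A\rhd\bot$; and as rules: modus ponens, necessitation, $\mathbf{R1}$: from $A\to B$ infer $C\rhd A\to C\rhd B$, and $\mathbf{R2}$: from $A\to B$ infer $B\rhd C\to A\rhd C$. $\mathbf{IL}^-(\mathbf{J2}_+,\mathbf{J5})$ is $\mathbf{IL}^-$ plus the schemes $\mathbf{J2}_+$: $A\rhd(B\lor C)\land B\rhd C\to A\rhd C$ and $\mathbf{J5}$: $\Diamond A\rhd A$. A simplified frame is a triple $(W,R,S)$ with $W$ a non-empty set, $R$ a transitive, conversely well-founded relation on $W$, and $S$ a binary relation on $W$. Forcing in a model on it is standard for Boolean connectives, $x\Vdash\Box A$ iff $y\Vdash A$ for all $y$ with $xRy$, and $x\Vdash A\rhd B$ iff for every $y$ with $xRy$ and $y\Vdash A$ there is $z$ with $xRz$, $ySz$ and $z\Vdash B$. Validity in a frame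 means being forced at every point under every valuation. A simplified $\mathbf{IL}^-(\mathbf{J2}_+,\mathbf{J5})$-frame is such a frame in which $S$ is transitive and $R\subseteq S$. -}

module Defs where

open import Data.Nat using (ℕ)
open import Data.Bool using (Bool; true; false; _∧_; _∨_; not)
open import Data.Product using (Σ; _×_; ∃)
open import Data.Sum using (_⊎_)
open import Data.Empty using (⊥)
open import Data.Unit using (⊤)
open import Relation.Binary.PropositionalEquality using (_≡_)
open import Relation.Nullary using (¬_)
open import Induction.WellFounded using (WellFounded)

infixr 5 _⇒_
infixl 7 _∧'_
infixl 6 _∨'_
infix 8 _▷_

data Fm : Set where
  var  : ℕ → Fm
  top  : Fm
  bot  : Fm
  _⇒_  : Fm → Fm → Fm
  _∨'_ : Fm → Fm → Fm
  _∧'_ : Fm → Fm → Fm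
  □    : Fm → Fm
  _▷_  : Fm → Fm → Fm

neg : Fm → Fm
neg A = A ⇒ bot

◇ : Fm → Fm
◇ A = neg (□ (neg A))

_⇔'_ : Fm → Fm → Fm
A ⇔' B = (A ⇒ B) ∧' (B ⇒ A)

_⇒ᵇ_ : Bool → Bool → Bool
a ⇒ᵇ b = not a ∨ b

evalB : (Fm → Bool) → Fm → Bool
evalB f (var p) = f (var p)
evalB f top = true
evalB f bot = false
evalB f (A ⇒ B) = evalB f A ⇒ᵇ evalB f B
evalB f (A ∨' B) = evalB f A ∨ evalB f B
evalB f (A ∧' B) = evalB f A ∧ evalB f B
evalB f (□ A) = f (□ A)
evalB f (A ▷ B) = f (A ▷ B)

Tautology : Fm → Set
Tautology A = (f : Fm → Bool) → evalB f A ≡ true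

data ⊢ : Fm → Set where
  taut : ∀ {A} → Tautology A → ⊢ A
  K    : ∀ {A B} → ⊢ (□ (A ⇒ B) ⇒ (□ A ⇒ □ B))
  L    : ∀ {A} → ⊢ (□ (□ A ⇒ A) ⇒ □ A)
  J3   : ∀ {A B C} → ⊢ ((A ▷ C) ∧' (B ▷ C) ⇒ (A ∨' B) ▷ C)
  J6   : ∀ {A} → ⊢ (□ (neg A) ⇔' (A ▷ bot))
  J2+  : ∀ {A B C} → ⊢ ((A ▷ (B ∨' C)) ∧' (B ▷ C) ⇒ A ▷ C)
  J5   : ∀ {A} → ⊢ (◇ A ▷ A)
  MP   : ∀ {A B} → ⊢ (A ⇒ B) → ⊢ A → ⊢ B
  Nec  : ∀ {A} → ⊢ A → ⊢ (□ A)
  R1   : ∀ {A B C} → ⊢ (A ⇒ B) → ⊢ (C ▷ A ⇒ C ▷ B)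
  R2   : ∀ {A B C} → ⊢ (A ⇒ B) → ⊢ (B ▷ C ⇒ A ▷ C)

-- Simplified frames: R transitive and conversely well-founded
-- (no infinite ascending R-chains, i.e. the converse of R is well-founded).
record SFrame : Set₁ where
  field
    W     : Set
    R     : W → W → Set
    S     : W → W → Set
    R-trans : ∀ {x y z} → R x y → R y z → R x z
    R-cwf   : WellFounded (λ y x → R x y)

record IsJ2+J5Frame (F : SFrame) : Set where
  open SFrame F
  field
    S-trans : ∀ {x y z} → S x y → S y z → S x z
    R⊆S     : ∀ {x y} → R x y → S x y

module _ (F : SFrame) where
  open SFrame F

  Valuation : Set₁
  Valuation = ℕ → W → Set

  _,_⊩_ : Valuation → W → Fm → Set
  V , x ⊩ var p = V p x
  V , x ⊩ top = ⊤
  V , x ⊩ bot = ⊥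
  V , x ⊩ (A ⇒ B) = V , x ⊩ A → V , x ⊩ B
  V , x ⊩ (A ∨' B) = V , x ⊩ A ⊎ V , x ⊩ B
  V , x ⊩ (A ∧' B) = V , x ⊩ A × V , x ⊩ B
  V , x ⊩ □ A = ∀ y → R x y → V , y ⊩ A
  V , x ⊩ (A ▷ B) = ∀ y → R x y → V , y ⊩ A →
                      Σ W (λ z → R x z × S y z × V , z ⊩ B)

  ValidIn : Fm → Set₁
  ValidIn A = (V : Valuation) (x : W) → V , x ⊩ A

ExcludedMiddle : Set₁
ExcludedMiddle = (P : Set) → P ⊎ ¬ P

-- Soundness is a direct check of each axiom and rule, using excluded middle
-- to read propositional tautologies and to find the successor required by J5.
--
-- For completeness, extend {¬A} to a maximal consistent set Γ₀ and grow a tree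
-- of MCSs from it. R is the ancestor relation; a child of x labelled D is a
-- D-critical successor of x (it contains no E with E ▷ D ∈ x) and contains a
-- box □G, G ∈ Φ, that x lacks, so for the finite set Φ read off from A the
-- relation R is conversely well-founded. S is generated by R and by side steps
-- from a world below a D-labelled child of x to a fresh D-labelled child of x
-- not containing D. Below x, the S-successors of a D-labelled child y of x thus
-- avoid D (except y itself), which refutes B ▷ C at x when B ▷ C ∉ x; when
-- B ▷ C ∈ x, Löb, J2₊ and J5 show that a fresh side-step child containing C
-- is consistent. The truth lemma then refutes A at the root.

module Submission where

open import Data.Bool using (Bool; true; false; T; _∧_; _∨_)
open import Data.Bool.Properties using (T-∧; T-≡)
open import Data.Empty using (⊥; ⊥-elim)
open import Data.Fin using (Fin; zero; suc)
open import Data.List using (List; []; _∷_; _++_; map; concatMap; cartesianProductWith)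
open import Data.List.Membership.Propositional using (_∈_)
open import Data.List.Membership.Propositional.Properties
  using (∈-++⁺ˡ; ∈-++⁺ʳ; ∈-map⁺; ∈-concat⁺′; ∈-cartesianProductWith⁺)
open import Data.List.Relation.Unary.All as All using (All; []; _∷_)
open import Data.List.Relation.Unary.All.Properties using (++⁺)
open import Data.List.Relation.Unary.Any using (here; there)
open import Data.Nat using (ℕ; zero; suc; _+_; _≤_; _<_; z≤n; s≤s; _≤′_; ≤′-refl; ≤′-step; _⊔_)
open import Data.Nat.Induction using (<-wellFounded)
open import Data.Nat.Properties
  using ( ≤⇒≤′; m≤m⊔n; m≤n⊔m; m≤m+n; m≤n+m; ≤-refl; <⇒≤; <-irrefl; <-trans; ≤-<-trans; <-≤-trans
        ; +-mono-≤; +-mono-<-≤; +-mono-≤-< )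
open import Data.Product using (Σ; Σ-syntax; ∃-syntax; _×_; _,_; proj₁; proj₂)
open import Data.Sum using (_⊎_; inj₁; inj₂; [_,_]′)
open import Data.Unit using (⊤; tt)
open import Data.Vec using (Vec; []; _∷_; lookup)
import Data.Vec as Vec
open import Data.Vec.Properties using (lookup-map)
open import Function using (_∘_; id; Equivalence)
open import Induction.WellFounded using (WellFounded; Acc; acc; module Subrelation)
import Relation.Binary.Construct.Closure.Transitive as Plus
open Plus using (TransClosure; [_]; _∷_)
import Relation.Binary.Construct.On as On
open import Relation.Binary.PropositionalEquality using (_≡_; refl; cong; cong₂; sym; trans)
open import Relation.Nullary using (¬_; Dec; yes; no; isYes; does; proof)
open import Relation.Nullary.Reflects using (Reflects; ofʸ; ofⁿ; _→-reflects_; _⊎-reflects_; _×-reflects_)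
open import Relation.Nullary.Decidable using (toWitness; fromWitness)
open import Relation.Unary using (Pred; _⊆_; _∪_; ｛_｝)

open import Defs

variable
  A B C D E : Fm

infixr 5 _⇒ₚ_
infixl 6 _∨ₚ_
infixl 7 _∧ₚ_
infix 9 ¬ₚ_

data Scheme (n : ℕ) : Set where
  ‵_ : Fin n → Scheme n
  ⊤ₚ ⊥ₚ : Scheme n
  _⇒ₚ_ _∨ₚ_ _∧ₚ_ : Scheme n → Scheme n → Scheme n
  ¬ₚ_ : Scheme n → Scheme n

ϕ : ∀ {n} → Scheme (suc n)
ϕ = ‵ zero

ψ : ∀ {n} → Scheme (suc (suc n))
ψ = ‵ suc zero

χ : ∀ {n} → Scheme (suc (suc (suc n)))
χ = ‵ suc (suc zero)

ϑ : ∀ {n} → Scheme (suc (suc (suc (suc n))))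
ϑ = ‵ suc (suc (suc zero))

instantiate : ∀ {n} → Vec Fm n → Scheme n → Fm
instantiate σ (‵ i) = lookup σ i
instantiate σ ⊤ₚ = top
instantiate σ ⊥ₚ = bot
instantiate σ (φ ⇒ₚ φ′) = instantiate σ φ ⇒ instantiate σ φ′
instantiate σ (φ ∨ₚ φ′) = instantiate σ φ ∨' instantiate σ φ′
instantiate σ (φ ∧ₚ φ′) = instantiate σ φ ∧' instantiate σ φ′
instantiate σ (¬ₚ φ) = neg (instantiate σ φ)

evalₚ : ∀ {n} → Vec Bool n → Scheme n → Bool
evalₚ v (‵ i) = lookup v i
evalₚ v ⊤ₚ = true
evalₚ v ⊥ₚ = false
evalₚ v (φ ⇒ₚ φ′) = evalₚ v φ ⇒ᵇ evalₚ v φ′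
evalₚ v (φ ∨ₚ φ′) = evalₚ v φ ∨ evalₚ v φ′
evalₚ v (φ ∧ₚ φ′) = evalₚ v φ ∧ evalₚ v φ′
evalₚ v (¬ₚ φ) = evalₚ v φ ⇒ᵇ false

evalB-instantiate : ∀ {n} (f : Fm → Bool) (σ : Vec Fm n) (φ : Scheme n) →
  evalB f (instantiate σ φ) ≡ evalₚ (Vec.map (evalB f) σ) φ
evalB-instantiate f σ (‵ i) = sym (lookup-map i (evalB f) σ)
evalB-instantiate f σ ⊤ₚ = refl
evalB-instantiate f σ ⊥ₚ = refl
evalB-instantiate f σ (φ ⇒ₚ φ′) = cong₂ _⇒ᵇ_ (evalB-instantiate f σ φ) (evalB-instantiate f σ φ′)
evalB-instantiate f σ (φ ∨ₚ φ′) = cong₂ _∨_ (evalB-instantiate f σ φ) (evalB-instantiate f σ φ′)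
evalB-instantiate f σ (φ ∧ₚ φ′) = cong₂ _∧_ (evalB-instantiate f σ φ) (evalB-instantiate f σ φ′)
evalB-instantiate f σ (¬ₚ φ) = cong (_⇒ᵇ false) (evalB-instantiate f σ φ)

every : ∀ n → (Vec Bool n → Bool) → Bool
every zero g = g []
every (suc n) g = every n (λ v → g (true ∷ v)) ∧ every n (λ v → g (false ∷ v))

every-sound : ∀ n (g : Vec Bool n → Bool) → T (every n g) → ∀ v → T (g v)
every-sound zero g ok [] = ok
every-sound (suc n) g ok (true ∷ v) = every-sound n _ (proj₁ (Equivalence.to T-∧ ok)) v
every-sound (suc n) g ok (false ∷ v) = every-sound n _ (proj₂ (Equivalence.to T-∧ ok)) v

-- The truth-table check is decided by evaluation, so the implicit argument
-- reduces to ⊤ and is filled in automatically for every actual tautology.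
⊢taut : ∀ {n} (φ : Scheme n) (σ : Vec Fm n) {_ : T (every n (λ v → evalₚ v φ))} →
  ⊢ (instantiate σ φ)
⊢taut {n} φ σ {ok} = taut λ f → trans (evalB-instantiate f σ φ)
  (Equivalence.to T-≡ (every-sound n (λ v → evalₚ v φ) ok (Vec.map (evalB f) σ)))

mp₂ : ⊢ (A ⇒ B ⇒ C) → ⊢ A → ⊢ B → ⊢ C
mp₂ d a b = MP (MP d a) b

⇒-trans : ⊢ (A ⇒ B) → ⊢ (B ⇒ C) → ⊢ (A ⇒ C)
⇒-trans {A} {B} {C} =
  mp₂ (⊢taut ((ϕ ⇒ₚ ψ) ⇒ₚ (ψ ⇒ₚ χ) ⇒ₚ ϕ ⇒ₚ χ) (A ∷ B ∷ C ∷ []))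

□-mono : ⊢ (A ⇒ B) → ⊢ (□ A ⇒ □ B)
□-mono d = MP K (Nec d)

□-mono₂ : ⊢ (A ⇒ B ⇒ C) → ⊢ (□ A ⇒ □ B ⇒ □ C)
□-mono₂ d = ⇒-trans (□-mono d) K

-- Axiom 4 from Löb's axiom applied to A ∧ □A.
□-4 : ⊢ (□ A ⇒ □ (□ A))
□-4 {A} = ⇒-trans (□-mono A⇒□A⁺⇒A⁺) (⇒-trans L (□-mono (⊢taut (ϕ ∧ₚ ψ ⇒ₚ ψ) (A ∷ □ A ∷ []))))
  where
    A⁺ = A ∧' □ A
    A⇒□A⁺⇒A⁺ : ⊢ (A ⇒ □ A⁺ ⇒ A⁺)
    A⇒□A⁺⇒A⁺ = MP (⊢taut ((χ ⇒ₚ ψ) ⇒ₚ ϕ ⇒ₚ χ ⇒ₚ ϕ ∧ₚ ψ) (A ∷ □ A ∷ □ A⁺ ∷ []))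
                (□-mono (⊢taut (ϕ ∧ₚ ψ ⇒ₚ ϕ) (A ∷ □ A ∷ [])))

-- Löb's axiom for ¬A: an A-world either is R-maximal among A-worlds or sees one.
löb-split : ⊢ (A ⇒ (A ∧' □ (neg A)) ∨' ◇ (A ∧' □ (neg A)))
löb-split {A} =
  MP (⊢taut ((ϕ ⇒ₚ ψ) ⇒ₚ χ ⇒ₚ (χ ∧ₚ ψ) ∨ₚ ¬ₚ ϕ) (□ (neg (A ∧' □ (neg A))) ∷ □ (neg A) ∷ A ∷ []))
     (⇒-trans (□-mono (⊢taut (¬ₚ (ϕ ∧ₚ ψ) ⇒ₚ ψ ⇒ₚ ¬ₚ ϕ) (A ∷ □ (neg A) ∷ []))) L)

□¬⇒▷⊥ : ⊢ (□ (neg A) ⇒ A ▷ bot)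
□¬⇒▷⊥ {A} = MP (⊢taut ((ϕ ⇒ₚ ψ) ∧ₚ (ψ ⇒ₚ ϕ) ⇒ₚ ϕ ⇒ₚ ψ) (□ (neg A) ∷ A ▷ bot ∷ [])) J6

▷⊥⇒□¬ : ⊢ (A ▷ bot ⇒ □ (neg A))
▷⊥⇒□¬ {A} = MP (⊢taut ((ϕ ⇒ₚ ψ) ∧ₚ (ψ ⇒ₚ ϕ) ⇒ₚ ψ ⇒ₚ ϕ) (□ (neg A) ∷ A ▷ bot ∷ [])) J6

⊥▷ : ⊢ (bot ▷ A)
⊥▷ {A} = MP (R1 (⊢taut (⊥ₚ ⇒ₚ ϕ) (A ∷ []))) (MP □¬⇒▷⊥ (Nec (⊢taut (¬ₚ ⊥ₚ) [])))

-- Consistency and the Lindenbaum lemma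

⋀ : List Fm → Fm
⋀ [] = top
⋀ (A ∷ As) = A ∧' ⋀ As

Theory : Set₁
Theory = Pred Fm _

Inconsistent : Theory → Set
Inconsistent Γ = Σ[ As ∈ List Fm ] All Γ As × ⊢ (⋀ As ⇒ bot)

Consistent : Theory → Set
Consistent Γ = ¬ Inconsistent Γ

inconsistent-mono : ∀ {Γ Δ : Theory} → Γ ⊆ Δ → Inconsistent Γ → Inconsistent Δ
inconsistent-mono Γ⊆Δ (As , Γ∋As , d) = As , All.map Γ⊆Δ Γ∋As , d

⋀-partition : ∀ {Γ Δ : Theory} {As} → All (Γ ∪ Δ) As → ⊢ (⋀ As ⇒ B) →
  Σ[ Xs ∈ List Fm ] Σ[ Ys ∈ List Fm ] All Γ Xs × All Δ Ys × ⊢ (⋀ Xs ⇒ ⋀ Ys ⇒ B)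
⋀-partition {B = B} [] d = [] , [] , [] , [] , MP (⊢taut ((⊤ₚ ⇒ₚ ϕ) ⇒ₚ ⊤ₚ ⇒ₚ ⊤ₚ ⇒ₚ ϕ) (B ∷ [])) d
⋀-partition {B = B} {As = A ∷ As} (A∈Γ∪Δ ∷ As∈Γ∪Δ) d
  with ⋀-partition As∈Γ∪Δ (MP (⊢taut ((ϕ ∧ₚ ψ ⇒ₚ χ) ⇒ₚ ψ ⇒ₚ ϕ ⇒ₚ χ) (A ∷ ⋀ As ∷ B ∷ [])) d)
... | Xs , Ys , Γ∋Xs , Δ∋Ys , e with A∈Γ∪Δ
... | inj₁ A∈Γ = A ∷ Xs , Ys , A∈Γ ∷ Γ∋Xs , Δ∋Ys ,
  MP (⊢taut ((ϕ ⇒ₚ ψ ⇒ₚ χ ⇒ₚ ϑ) ⇒ₚ χ ∧ₚ ϕ ⇒ₚ ψ ⇒ₚ ϑ) (⋀ Xs ∷ ⋀ Ys ∷ A ∷ B ∷ [])) e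
... | inj₂ A∈Δ = Xs , A ∷ Ys , Γ∋Xs , A∈Δ ∷ Δ∋Ys ,
  MP (⊢taut ((ϕ ⇒ₚ ψ ⇒ₚ χ ⇒ₚ ϑ) ⇒ₚ ϕ ⇒ₚ χ ∧ₚ ψ ⇒ₚ ϑ) (⋀ Xs ∷ ⋀ Ys ∷ A ∷ B ∷ [])) e

⋀-replicate : ∀ {As} → All ｛ A ｝ As → ⊢ (A ⇒ ⋀ As)
⋀-replicate {A} [] = ⊢taut (ϕ ⇒ₚ ⊤ₚ) (A ∷ [])
⋀-replicate {A} {As = _ ∷ As} (refl ∷ As≡A) =
  MP (⊢taut ((ϕ ⇒ₚ ψ) ⇒ₚ ϕ ⇒ₚ ϕ ∧ₚ ψ) (A ∷ ⋀ As ∷ [])) (⋀-replicate As≡A)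

⋀-++ : ∀ Xs Ys → ⊢ (⋀ (Xs ++ Ys) ⇒ ⋀ Xs ∧' ⋀ Ys)
⋀-++ [] Ys = ⊢taut (ϕ ⇒ₚ ⊤ₚ ∧ₚ ϕ) (⋀ Ys ∷ [])
⋀-++ (X ∷ Xs) Ys = MP (⊢taut ((ϑ ⇒ₚ ψ ∧ₚ χ) ⇒ₚ ϕ ∧ₚ ϑ ⇒ₚ (ϕ ∧ₚ ψ) ∧ₚ χ)
                          (X ∷ ⋀ Xs ∷ ⋀ Ys ∷ ⋀ (Xs ++ Ys) ∷ []))
                      (⋀-++ Xs Ys)

deduction : ∀ {Γ : Theory} → Inconsistent (Γ ∪ ｛ A ｝) →
  Σ[ As ∈ List Fm ] All Γ As × ⊢ (⋀ As ⇒ neg A)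
deduction {A} (_ , Γ,A∋As , d) with ⋀-partition Γ,A∋As d
... | Xs , Ys , Γ∋Xs , Ys≡A , e = Xs , Γ∋Xs ,
  ⇒-trans e (MP (⊢taut ((ϕ ⇒ₚ ψ) ⇒ₚ ¬ₚ ψ ⇒ₚ ¬ₚ ϕ) (A ∷ ⋀ Ys ∷ [])) (⋀-replicate Ys≡A))

binaryConnectives : List (Fm → Fm → Fm)
binaryConnectives = _⇒_ ∷ _∨'_ ∷ _∧'_ ∷ _▷_ ∷ []

enum : ℕ → List Fm
enum zero = top ∷ bot ∷ []
enum (suc n) = enum n ++ var n ∷ map □ (enum n) ++
  concatMap (λ _∙_ → cartesianProductWith _∙_ (enum n) (enum n)) binaryConnectives

enum-mono : ∀ {m n} → m ≤′ n → ∀ {A} → A ∈ enum m → A ∈ enum n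
enum-mono ≤′-refl = id
enum-mono (≤′-step m≤n) = ∈-++⁺ˡ ∘ enum-mono m≤n

enum-binary : ∀ {_∙_} → _∙_ ∈ binaryConnectives → ∃[ i ] A ∈ enum i → ∃[ j ] B ∈ enum j →
  ∃[ k ] (A ∙ B) ∈ enum k
enum-binary {_∙_ = _∙_} ∙∈ (i , A∈) (j , B∈) = suc (i ⊔ j) ,
  ∈-++⁺ʳ (enum (i ⊔ j)) (there (∈-++⁺ʳ (map □ (enum (i ⊔ j)))
    (∈-concat⁺′ (∈-cartesianProductWith⁺ _∙_ (enum-mono (≤⇒≤′ (m≤m⊔n i j)) A∈)
                                            (enum-mono (≤⇒≤′ (m≤n⊔m i j)) B∈))
                (∈-map⁺ (λ _∘_ → cartesianProductWith _∘_ (enum (i ⊔ j)) (enum (i ⊔ j))) ∙∈))))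

enum-complete : ∀ A → ∃[ n ] A ∈ enum n
enum-complete (var p) = suc p , ∈-++⁺ʳ (enum p) (here refl)
enum-complete top = 0 , here refl
enum-complete bot = 0 , there (here refl)
enum-complete (□ A) with enum-complete A
... | n , A∈ = suc n , ∈-++⁺ʳ (enum n) (there (∈-++⁺ˡ (∈-map⁺ □ A∈)))
enum-complete (A ⇒ B) = enum-binary (here refl) (enum-complete A) (enum-complete B)
enum-complete (A ∨' B) = enum-binary (there (here refl)) (enum-complete A) (enum-complete B)
enum-complete (A ∧' B) = enum-binary (there (there (here refl))) (enum-complete A) (enum-complete B)
enum-complete (A ▷ B) =
  enum-binary (there (there (there (here refl)))) (enum-complete A) (enum-complete B)

decide : ExcludedMiddle → (P : Set) → Dec P
decide lem P = [ yes , no ]′ (lem P)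

-- Membership is Bool-valued so that MCS, and hence the trees of MCSs used
-- as worlds of the canonical frame, live in Set.
record MCS : Set where
  field
    mem            : Fm → Bool
    mem-⊢          : ∀ {A} → ⊢ A → T (mem A)
    mem-MP         : ∀ {A B} → T (mem (A ⇒ B)) → T (mem A) → T (mem B)
    mem-consistent : ¬ T (mem bot)
    mem-complete   : ∀ A → T (mem A) ⊎ T (mem (neg A))

infix 4 _∋_

-- A record rather than T (mem Γ A), so that Γ can be inferred from the type.
record _∋_ (Γ : MCS) (A : Fm) : Set where
  constructor in-mcs
  field out : T (MCS.mem Γ A)

module Lindenbaum (lem : ExcludedMiddle) where

  extend : Theory → Fm → Theory
  extend Γ A with decide lem (Inconsistent (Γ ∪ ｛ A ｝))
  ... | yes _ = Γ ∪ ｛ neg A ｝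
  ... | no _ = Γ ∪ ｛ A ｝

  extend-⊇ : ∀ Γ A → Γ ⊆ extend Γ A
  extend-⊇ Γ A with decide lem (Inconsistent (Γ ∪ ｛ A ｝))
  ... | yes _ = inj₁
  ... | no _ = inj₁

  extend-decides : ∀ Γ A → extend Γ A A ⊎ extend Γ A (neg A)
  extend-decides Γ A with decide lem (Inconsistent (Γ ∪ ｛ A ｝))
  ... | yes _ = inj₂ (inj₂ refl)
  ... | no _ = inj₁ (inj₂ refl)

  extend-consistent : ∀ Γ A → Consistent Γ → Consistent (extend Γ A)
  extend-consistent Γ A Γ-cons with decide lem (Inconsistent (Γ ∪ ｛ A ｝))
  ... | no Γ,A-cons = Γ,A-cons
  ... | yes Γ,A-incons = λ Γ,¬A-incons → refute (deduction Γ,A-incons) (deduction Γ,¬A-incons)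
    where
      refute : Σ[ Xs ∈ List Fm ] All Γ Xs × ⊢ (⋀ Xs ⇒ neg A) →
               Σ[ Ys ∈ List Fm ] All Γ Ys × ⊢ (⋀ Ys ⇒ neg (neg A)) → ⊥
      refute (Xs , Γ∋Xs , ⊢¬A) (Ys , Γ∋Ys , ⊢¬¬A) = Γ-cons (Xs ++ Ys , ++⁺ Γ∋Xs Γ∋Ys ,
        ⇒-trans (⋀-++ Xs Ys)
          (mp₂ (⊢taut ((ϕ ⇒ₚ ¬ₚ χ) ⇒ₚ (ψ ⇒ₚ ¬ₚ ¬ₚ χ) ⇒ₚ ϕ ∧ₚ ψ ⇒ₚ ⊥ₚ) (⋀ Xs ∷ ⋀ Ys ∷ A ∷ []))
               ⊢¬A ⊢¬¬A))

  extendAll : Theory → List Fm → Theory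
  extendAll Γ [] = Γ
  extendAll Γ (A ∷ As) = extendAll (extend Γ A) As

  extendAll-⊇ : ∀ Γ As → Γ ⊆ extendAll Γ As
  extendAll-⊇ Γ [] = id
  extendAll-⊇ Γ (A ∷ As) = extendAll-⊇ (extend Γ A) As ∘ extend-⊇ Γ A

  extendAll-consistent : ∀ Γ As → Consistent Γ → Consistent (extendAll Γ As)
  extendAll-consistent Γ [] = id
  extendAll-consistent Γ (A ∷ As) = extendAll-consistent (extend Γ A) As ∘ extend-consistent Γ A

  extendAll-decides : ∀ Γ {As} → A ∈ As → extendAll Γ As A ⊎ extendAll Γ As (neg A)
  extendAll-decides Γ {A ∷ As} (here refl) with extend-decides Γ A
  ... | inj₁ Δ∋A = inj₁ (extendAll-⊇ _ As Δ∋A)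
  ... | inj₂ Δ∋¬A = inj₂ (extendAll-⊇ _ As Δ∋¬A)
  extendAll-decides Γ {B ∷ As} (there A∈As) = extendAll-decides (extend Γ B) A∈As

  stage : Theory → ℕ → Theory
  stage Γ zero = Γ
  stage Γ (suc n) = extendAll (stage Γ n) (enum n)

  stage-mono : ∀ Γ {m n} → m ≤′ n → stage Γ m ⊆ stage Γ n
  stage-mono Γ ≤′-refl = id
  stage-mono Γ {n = suc n} (≤′-step m≤n) = extendAll-⊇ (stage Γ n) (enum n) ∘ stage-mono Γ m≤n

  stage-consistent : ∀ Γ n → Consistent Γ → Consistent (stage Γ n)
  stage-consistent Γ zero = id
  stage-consistent Γ (suc n) = extendAll-consistent (stage Γ n) (enum n) ∘ stage-consistent Γ n

  limit : Theory → Theory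
  limit Γ A = ∃[ n ] stage Γ n A

  limit-bounded : ∀ Γ {As} → All (limit Γ) As → ∃[ n ] All (stage Γ n) As
  limit-bounded Γ [] = 0 , []
  limit-bounded Γ ((i , A∈) ∷ As∈) with limit-bounded Γ As∈
  ... | j , As∈ⱼ = i ⊔ j , stage-mono Γ (≤⇒≤′ (m≤m⊔n i j)) A∈
                         ∷ All.map (stage-mono Γ (≤⇒≤′ (m≤n⊔m i j))) As∈ⱼ

  limit-consistent : ∀ Γ → Consistent Γ → Consistent (limit Γ)
  limit-consistent Γ Γ-cons (As , As∈ , d) with limit-bounded Γ As∈
  ... | n , As∈ₙ = stage-consistent Γ n Γ-cons (As , As∈ₙ , d)

  limit-decides : ∀ Γ A → limit Γ A ⊎ limit Γ (neg A)
  limit-decides Γ A with enum-complete A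
  ... | n , A∈ = [ (λ Γ∋A → inj₁ (suc n , Γ∋A)) , (λ Γ∋¬A → inj₂ (suc n , Γ∋¬A)) ]′
                   (extendAll-decides (stage Γ n) A∈)

  lindenbaum : ∀ {Γ} → Consistent Γ → Σ[ Δ ∈ MCS ] Γ ⊆ (Δ ∋_)
  lindenbaum {Γ} Γ-cons = Δ , λ Γ∋A → in-mcs (mem-intro (0 , Γ∋A))
    where
      Γ* = limit Γ
      Γ*-cons = limit-consistent Γ Γ-cons
      mem : Fm → Bool
      mem A = isYes (decide lem (Γ* A))
      ∈Γ* : T (mem A) → Γ* A
      ∈Γ* {A} = toWitness {a? = decide lem (Γ* A)}
      mem-intro : Γ* A → T (mem A)
      mem-intro {A} = fromWitness {a? = decide lem (Γ* A)}
      Γ*-closed : ⊢ A → Γ* A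
      Γ*-closed {A} ⊢A with limit-decides Γ A
      ... | inj₁ A∈ = A∈
      ... | inj₂ ¬A∈ = ⊥-elim (Γ*-cons (neg A ∷ [] , ¬A∈ ∷ [] ,
                                MP (⊢taut (ϕ ⇒ₚ ¬ₚ ϕ ∧ₚ ⊤ₚ ⇒ₚ ⊥ₚ) (A ∷ [])) ⊢A))
      Γ*-MP : Γ* (A ⇒ B) → Γ* A → Γ* B
      Γ*-MP {A} {B} A⇒B∈ A∈ with limit-decides Γ B
      ... | inj₁ B∈ = B∈
      ... | inj₂ ¬B∈ = ⊥-elim (Γ*-cons ((A ⇒ B) ∷ A ∷ neg B ∷ [] , A⇒B∈ ∷ A∈ ∷ ¬B∈ ∷ [] ,
                                ⊢taut ((ϕ ⇒ₚ ψ) ∧ₚ (ϕ ∧ₚ (¬ₚ ψ ∧ₚ ⊤ₚ)) ⇒ₚ ⊥ₚ) (A ∷ B ∷ [])))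
      Δ : MCS
      Δ = record
        { mem = mem
        ; mem-⊢ = mem-intro ∘ Γ*-closed
        ; mem-MP = λ A⇒B∈ A∈ → mem-intro (Γ*-MP (∈Γ* A⇒B∈) (∈Γ* A∈))
        ; mem-consistent = λ ⊥∈ → Γ*-cons (bot ∷ [] , ∈Γ* ⊥∈ ∷ [] , ⊢taut (⊥ₚ ∧ₚ ⊤ₚ ⇒ₚ ⊥ₚ) [])
        ; mem-complete = λ A → [ inj₁ ∘ mem-intro , inj₂ ∘ mem-intro ]′ (limit-decides Γ A)
        }

module _ {Γ : MCS} where
  open _∋_

  ∋-⊢ : ⊢ A → Γ ∋ A
  ∋-⊢ ⊢A = in-mcs (MCS.mem-⊢ Γ ⊢A)

  ∋-MP : Γ ∋ A ⇒ B → Γ ∋ A → Γ ∋ B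
  ∋-MP A⇒B∈ A∈ = in-mcs (MCS.mem-MP Γ (out A⇒B∈) (out A∈))

  ∋-⇒ : ⊢ (A ⇒ B) → Γ ∋ A → Γ ∋ B
  ∋-⇒ = ∋-MP ∘ ∋-⊢

  ∋-⇒₂ : ⊢ (A ⇒ B ⇒ C) → Γ ∋ A → Γ ∋ B → Γ ∋ C
  ∋-⇒₂ d A∈ = ∋-MP (∋-⇒ d A∈)

  ∌bot : ¬ Γ ∋ bot
  ∌bot = MCS.mem-consistent Γ ∘ out

  ∋-complete : ∀ A → Γ ∋ A ⊎ Γ ∋ neg A
  ∋-complete A = [ inj₁ ∘ in-mcs , inj₂ ∘ in-mcs ]′ (MCS.mem-complete Γ A)

  ∋neg⇒∌ : Γ ∋ neg A → ¬ Γ ∋ A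
  ∋neg⇒∌ ¬A∈ A∈ = ∌bot (∋-MP ¬A∈ A∈)

  ∌⇒∋neg : ¬ Γ ∋ A → Γ ∋ neg A
  ∌⇒∋neg {A} A∉ = [ ⊥-elim ∘ A∉ , id ]′ (∋-complete A)

  ∋-proj₁ : Γ ∋ A ∧' B → Γ ∋ A
  ∋-proj₁ {A} {B} = ∋-⇒ (⊢taut (ϕ ∧ₚ ψ ⇒ₚ ϕ) (A ∷ B ∷ []))

  ∋-proj₂ : Γ ∋ A ∧' B → Γ ∋ B
  ∋-proj₂ {A} {B} = ∋-⇒ (⊢taut (ϕ ∧ₚ ψ ⇒ₚ ψ) (A ∷ B ∷ []))

  ∋-□⋀ : ∀ {As} → All (λ A → Γ ∋ □ A) As → Γ ∋ □ (⋀ As)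
  ∋-□⋀ [] = ∋-⊢ (Nec (⊢taut ⊤ₚ []))
  ∋-□⋀ {A ∷ As} (□A∈ ∷ □As∈) =
    ∋-⇒₂ (□-mono₂ (⊢taut (ϕ ⇒ₚ ψ ⇒ₚ ϕ ∧ₚ ψ) (A ∷ ⋀ As ∷ []))) □A∈ (∋-□⋀ □As∈)

  ▷-R1 : ⊢ (A ⇒ B) → Γ ∋ C ▷ A → Γ ∋ C ▷ B
  ▷-R1 = ∋-⇒ ∘ R1

  ▷-R2 : ⊢ (A ⇒ B) → Γ ∋ B ▷ C → Γ ∋ A ▷ C
  ▷-R2 = ∋-⇒ ∘ R2

  ▷-J3 : Γ ∋ A ▷ C → Γ ∋ B ▷ C → Γ ∋ (A ∨' B) ▷ C
  ▷-J3 {A} {C} {B} = ∋-⇒₂ (MP (⊢taut ((ϕ ∧ₚ ψ ⇒ₚ χ) ⇒ₚ ϕ ⇒ₚ ψ ⇒ₚ χ)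
                                    (A ▷ C ∷ B ▷ C ∷ (A ∨' B) ▷ C ∷ [])) J3)

  ▷-J2+ : Γ ∋ A ▷ (B ∨' C) → Γ ∋ B ▷ C → Γ ∋ A ▷ C
  ▷-J2+ {A} {B} {C} = ∋-⇒₂ (MP (⊢taut ((ϕ ∧ₚ ψ ⇒ₚ χ) ⇒ₚ ϕ ⇒ₚ ψ ⇒ₚ χ)
                                     (A ▷ (B ∨' C) ∷ B ▷ C ∷ A ▷ C ∷ [])) J2+)

  ▷-trans : Γ ∋ A ▷ B → Γ ∋ B ▷ C → Γ ∋ A ▷ C
  ▷-trans {B = B} {C} A▷B = ▷-J2+ (▷-R1 (⊢taut (ϕ ⇒ₚ ϕ ∨ₚ ψ) (B ∷ C ∷ [])) A▷B)

  ▷-◇ : Γ ∋ A ▷ B → Γ ∋ ◇ A ▷ B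
  ▷-◇ = ▷-trans (∋-⊢ J5)

  □¬⇒▷ : Γ ∋ □ (neg A) → Γ ∋ A ▷ B
  □¬⇒▷ {B = B} = ▷-R1 (⊢taut (⊥ₚ ⇒ₚ ϕ) (B ∷ [])) ∘ ∋-⇒ □¬⇒▷⊥

  ▷-löbˡ : Γ ∋ (A ∧' □ (neg A)) ▷ B → Γ ∋ A ▷ B
  ▷-löbˡ A⁻▷B = ▷-R2 löb-split (▷-J3 A⁻▷B (▷-◇ A⁻▷B))

  ▷-löbʳ : Γ ∋ A ▷ B → Γ ∋ A ▷ (B ∧' □ (neg B))
  ▷-löbʳ {B = B} A▷B =
    ▷-J2+ (▷-R1 (MP (⊢taut ((ϕ ⇒ₚ ψ ∨ₚ χ) ⇒ₚ ϕ ⇒ₚ χ ∨ₚ ψ) (B ∷ B⁻ ∷ ◇ B⁻ ∷ [])) löb-split) A▷B)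
          (∋-⊢ J5)
    where B⁻ = B ∧' □ (neg B)

  ▷-□ʳ : Γ ∋ A ▷ B → Γ ∋ □ (B ⇒ C) → Γ ∋ A ▷ C
  ▷-□ʳ {B = B} {C} A▷B □B⇒C =
    ▷-R1 (⊢taut (ϕ ∧ₚ ψ ⇒ₚ ψ) (B ∷ C ∷ []))
      (▷-J2+ (▷-R1 (⊢taut (ϕ ⇒ₚ (ϕ ∧ₚ ¬ₚ ψ) ∨ₚ (ϕ ∧ₚ ψ)) (B ∷ C ∷ [])) A▷B)
             (□¬⇒▷ (∋-⇒ (□-mono (⊢taut ((ϕ ⇒ₚ ψ) ⇒ₚ ¬ₚ (ϕ ∧ₚ ¬ₚ ψ)) (B ∷ C ∷ []))) □B⇒C)))

  ▷-□ˡ : Γ ∋ □ (A ⇒ B) → Γ ∋ B ▷ C → Γ ∋ A ▷ C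
  ▷-□ˡ {A} {B} □A⇒B B▷C =
    ▷-R2 (⊢taut (ϕ ⇒ₚ (ϕ ∧ₚ ¬ₚ ψ) ∨ₚ ψ) (A ∷ B ∷ []))
      (▷-J3 (□¬⇒▷ (∋-⇒ (□-mono (⊢taut ((ϕ ⇒ₚ ψ) ⇒ₚ ¬ₚ (ϕ ∧ₚ ¬ₚ ψ)) (A ∷ B ∷ []))) □A⇒B)) B▷C)

-- Critical successors

Boxed : MCS → Theory
Boxed Γ A = Γ ∋ □ A

Critical : Fm → MCS → MCS → Set
Critical D Γ Δ = ∀ {E} → Δ ∋ E → ¬ Γ ∋ E ▷ D

Refuted : MCS → Fm → Theory
Refuted Γ D A = Σ[ E ∈ Fm ] neg E ≡ A × Γ ∋ E ▷ D

-- The theory a D-critical successor of Γ containing A has to extend.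
Successors : MCS → Fm → Fm → Theory
Successors Γ A D = Boxed Γ ∪ ｛ A ｝ ∪ Refuted Γ D

refuted-⋀ : ∀ {Γ As} → All (｛ A ｝ ∪ Refuted Γ D) As →
  Σ[ E ∈ Fm ] Γ ∋ E ▷ D × ⊢ (A ∧' neg E ⇒ ⋀ As)
refuted-⋀ {A} [] = bot , ∋-⊢ ⊥▷ , ⊢taut (ϕ ∧ₚ ¬ₚ ⊥ₚ ⇒ₚ ⊤ₚ) (A ∷ [])
refuted-⋀ {A} {As = _ ∷ As} (inj₁ refl ∷ rest) with refuted-⋀ rest
... | E , E▷D , d = E , E▷D , MP (⊢taut ((ϕ ∧ₚ ¬ₚ ψ ⇒ₚ χ) ⇒ₚ ϕ ∧ₚ ¬ₚ ψ ⇒ₚ ϕ ∧ₚ χ) (A ∷ E ∷ ⋀ As ∷ [])) d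
refuted-⋀ {A} {As = _ ∷ As} (inj₂ (E′ , refl , E′▷D) ∷ rest) with refuted-⋀ rest
... | E , E▷D , d = E′ ∨' E , ▷-J3 E′▷D E▷D ,
  MP (⊢taut ((ϕ ∧ₚ ¬ₚ ψ ⇒ₚ χ) ⇒ₚ ϕ ∧ₚ ¬ₚ (ϑ ∨ₚ ψ) ⇒ₚ ¬ₚ ϑ ∧ₚ χ) (A ∷ E ∷ ⋀ As ∷ E′ ∷ [])) d

successors-inconsistent : ∀ {Γ} → Inconsistent (Successors Γ A D) →
  Σ[ E ∈ Fm ] Γ ∋ E ▷ D × Γ ∋ □ (A ⇒ E)
successors-inconsistent {A} (_ , As∈ , d) with ⋀-partition As∈ d
... | Xs , Ys , □Xs∈ , Ys∈ , e with refuted-⋀ Ys∈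
... | E , E▷D , f = E , E▷D ,
  ∋-⇒ (□-mono (mp₂ (⊢taut ((ϕ ⇒ₚ ψ ⇒ₚ ⊥ₚ) ⇒ₚ (χ ∧ₚ ¬ₚ ϑ ⇒ₚ ψ) ⇒ₚ ϕ ⇒ₚ χ ⇒ₚ ϑ)
                          (⋀ Xs ∷ ⋀ Ys ∷ A ∷ E ∷ [])) e f))
      (∋-□⋀ □Xs∈)

critical-successor : ExcludedMiddle → ∀ {Γ} → Consistent (Successors Γ A D) →
  Σ[ Δ ∈ MCS ] Boxed Γ ⊆ (Δ ∋_) × Δ ∋ A × Critical D Γ Δ
critical-successor lem cons with Lindenbaum.lindenbaum lem cons
... | Δ , Succ⊆Δ = Δ , Succ⊆Δ ∘ inj₁ , Succ⊆Δ (inj₂ (inj₁ refl)) ,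
  λ E∈Δ E▷D → ∋neg⇒∌ (Succ⊆Δ (inj₂ (inj₂ (_ , refl , E▷D)))) E∈Δ

□-successors-consistent : ∀ {Γ} → ¬ Γ ∋ □ A → Consistent (Successors Γ (neg A ∧' □ A) bot)
□-successors-consistent {A} □A∉ incons with successors-inconsistent incons
... | E , E▷⊥ , □⇒E = □A∉ (∋-⇒ L (∋-⇒₂ (□-mono₂ (⊢taut ((¬ₚ ϕ ∧ₚ ψ ⇒ₚ χ) ⇒ₚ ¬ₚ χ ⇒ₚ ψ ⇒ₚ ϕ)
                                                        (A ∷ □ A ∷ E ∷ [])))
                                            □⇒E (∋-⇒ ▷⊥⇒□¬ E▷⊥)))

¬▷-successors-consistent : ∀ {Γ} → Γ ∋ neg (B ▷ C) →
  Consistent (Successors Γ (B ∧' □ (neg B)) C)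
¬▷-successors-consistent ¬B▷C incons with successors-inconsistent incons
... | E , E▷C , □⇒E = ∋neg⇒∌ ¬B▷C (▷-löbˡ (▷-□ˡ □⇒E E▷C))

▷-successors-consistent : ∀ {Γ Δ} → Γ ∋ B ▷ C → Δ ∋ B → Critical D Γ Δ →
  Consistent (Successors Γ (C ∧' □ (neg C) ∧' neg D) D)
▷-successors-consistent {B} {C} {D} {Γ} B▷C B∈Δ Δ-crit incons with successors-inconsistent incons
... | E , E▷D , □F⇒E = Δ-crit B∈Δ (▷-J2+ B▷E∨D E▷D)
  where
    F = C ∧' □ (neg C) ∧' neg D
    B▷F∨D : Γ ∋ B ▷ (F ∨' D)
    B▷F∨D = ▷-R1 (⊢taut (ϕ ∧ₚ ψ ⇒ₚ (ϕ ∧ₚ ψ ∧ₚ ¬ₚ χ) ∨ₚ χ) (C ∷ □ (neg C) ∷ D ∷ [])) (▷-löbʳ B▷C)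
    B▷E∨D : Γ ∋ B ▷ (E ∨' D)
    B▷E∨D = ▷-□ʳ B▷F∨D (∋-⇒ (□-mono (⊢taut ((ϕ ⇒ₚ ψ) ⇒ₚ ϕ ∨ₚ χ ⇒ₚ ψ ∨ₚ χ) (F ∷ E ∷ D ∷ []))) □F⇒E)

-- Worlds of the canonical frame are nodes of a tree of MCSs: node p Δ D t is
-- a D-critical successor of p. The origin t is the world that node was
-- created to be an S-successor of (root if none); it keeps such witnesses
-- apart and makes size strictly increase along S.
data Tree : Set where
  root : Tree
  node : (parent : Tree) (Δ : MCS) (label : Fm) (origin : Tree) → Tree

size : Tree → ℕ
size root = 0
size (node p Δ D t) = suc (size p + size t)

infix 4 _⊏_ _⊑_

data _⊏_ : Tree → Tree → Set where
  parent   : ∀ {p Δ D t} → p ⊏ node p Δ D t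
  ancestor : ∀ {a p Δ D t} → a ⊏ p → a ⊏ node p Δ D t

_⊑_ : Tree → Tree → Set
a ⊑ b = a ≡ b ⊎ a ⊏ b

⊏-trans : ∀ {a b c} → a ⊏ b → b ⊏ c → a ⊏ c
⊏-trans a⊏b parent = ancestor a⊏b
⊏-trans a⊏b (ancestor b⊏c) = ancestor (⊏-trans a⊏b b⊏c)

⊑-⊏-trans : ∀ {a b c} → a ⊑ b → b ⊏ c → a ⊏ c
⊑-⊏-trans (inj₁ refl) = id
⊑-⊏-trans (inj₂ a⊏b) = ⊏-trans a⊏b

⊏-node⁻¹ : ∀ {a p Δ D t} → a ⊏ node p Δ D t → a ⊑ p
⊏-node⁻¹ parent = inj₁ refl
⊏-node⁻¹ (ancestor a⊏p) = inj₂ a⊏p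

⊏-linear : ∀ {a b c} → a ⊏ c → b ⊏ c → a ⊏ b ⊎ a ≡ b ⊎ b ⊏ a
⊏-linear parent parent = inj₂ (inj₁ refl)
⊏-linear parent (ancestor b⊏a) = inj₂ (inj₂ b⊏a)
⊏-linear (ancestor a⊏b) parent = inj₁ a⊏b
⊏-linear (ancestor a⊏p) (ancestor b⊏p) = ⊏-linear a⊏p b⊏p

size-parent : ∀ p Δ D t → size p < size (node p Δ D t)
size-parent p Δ D t = s≤s (m≤m+n (size p) (size t))

size-origin : ∀ p Δ D t → size t < size (node p Δ D t)
size-origin p Δ D t = s≤s (m≤n+m (size t) (size p))

size-⊏ : ∀ {a b} → a ⊏ b → size a < size b
size-⊏ (parent {p} {Δ} {D} {t}) = size-parent p Δ D t
size-⊏ (ancestor {p = p} {Δ} {D} {t} a⊏p) = <-trans (size-⊏ a⊏p) (size-parent p Δ D t)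

size-⊑ : ∀ {a b} → a ⊑ b → size a ≤ size b
size-⊑ (inj₁ refl) = ≤-refl
size-⊑ (inj₂ a⊏b) = <⇒≤ (size-⊏ a⊏b)

⋢-parent : ∀ {p Δ D t} → ¬ node p Δ D t ⊑ p
⋢-parent {p} {Δ} {D} {t} c⊑p = <-irrefl refl (≤-<-trans (size-⊑ c⊑p) (size-parent p Δ D t))

child-on-path : ∀ {a b} → a ⊏ b → Σ[ Δ ∈ MCS ] Σ[ D ∈ Fm ] Σ[ t ∈ Tree ] node a Δ D t ⊑ b
child-on-path (parent {Δ = Δ} {D} {t}) = Δ , D , t , inj₁ refl
child-on-path (ancestor a⊏p) with child-on-path a⊏p
... | Δ , D , t , c⊑p = Δ , D , t , inj₂ (⊑-⊏-trans c⊑p parent)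

child-on-path-unique : ∀ {a Δ D t Δ′ D′ t′ b} → node a Δ D t ⊑ b → node a Δ′ D′ t′ ⊑ b →
  node a Δ D t ≡ node a Δ′ D′ t′
child-on-path-unique (inj₁ refl) (inj₁ c′≡b) = sym c′≡b
child-on-path-unique (inj₁ refl) (inj₂ c′⊏b) = ⊥-elim (⋢-parent (⊏-node⁻¹ c′⊏b))
child-on-path-unique (inj₂ c⊏b) (inj₁ refl) = ⊥-elim (⋢-parent (⊏-node⁻¹ c⊏b))
child-on-path-unique (inj₂ c⊏b) (inj₂ c′⊏b) with ⊏-linear c⊏b c′⊏b
... | inj₁ c⊏c′ = ⊥-elim (⋢-parent (⊏-node⁻¹ c⊏c′))
... | inj₂ (inj₁ c≡c′) = c≡c′
... | inj₂ (inj₂ c′⊏c) = ⊥-elim (⋢-parent (⊏-node⁻¹ c′⊏c))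

child-on-path-below : ∀ {a Δ D t a′ b} → node a Δ D t ⊑ b → a ⊏ a′ → a′ ⊏ b → node a Δ D t ⊑ a′
child-on-path-below (inj₁ refl) a⊏a′ a′⊏b =
  ⊥-elim (<-irrefl refl (<-≤-trans (size-⊏ a⊏a′) (size-⊑ (⊏-node⁻¹ a′⊏b))))
child-on-path-below (inj₂ c⊏b) a⊏a′ a′⊏b with ⊏-linear c⊏b a′⊏b
... | inj₁ c⊏a′ = inj₂ c⊏a′
... | inj₂ (inj₁ c≡a′) = inj₁ c≡a′
... | inj₂ (inj₂ a′⊏c) = ⊥-elim (<-irrefl refl (≤-<-trans (size-⊑ (⊏-node⁻¹ a′⊏c)) (size-⊏ a⊏a′)))

-- The canonical model

indicator : Bool → ℕ
indicator true = 0
indicator false = 1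

indicator-antitone : ∀ {a b} → (T a → T b) → indicator b ≤ indicator a
indicator-antitone {true} {true} _ = z≤n
indicator-antitone {true} {false} a⇒b = ⊥-elim (a⇒b tt)
indicator-antitone {false} {true} _ = z≤n
indicator-antitone {false} {false} _ = ≤-refl

indicator-< : ∀ {a b} → T b → ¬ T a → indicator b < indicator a
indicator-< {true} _ ¬a = ⊥-elim (¬a tt)
indicator-< {false} {true} _ _ = s≤s z≤n

missing : MCS → List Fm → ℕ
missing Γ [] = 0
missing Γ (G ∷ Gs) = indicator (MCS.mem Γ (□ G)) + missing Γ Gs

module _ {Γ Δ : MCS} (Γ⊆Δ : Boxed Γ ⊆ Boxed Δ) where
  open _∋_

  missing-antitone : ∀ Gs → missing Δ Gs ≤ missing Γ Gs
  missing-antitone [] = z≤n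
  missing-antitone (G ∷ Gs) =
    +-mono-≤ (indicator-antitone (out ∘ Γ⊆Δ ∘ in-mcs)) (missing-antitone Gs)

  missing-< : ∀ {G Gs} → G ∈ Gs → Δ ∋ □ G → ¬ Γ ∋ □ G → missing Δ Gs < missing Γ Gs
  missing-< {Gs = _ ∷ Gs} (here refl) □G∈Δ □G∉Γ =
    +-mono-<-≤ (indicator-< (out □G∈Δ) (□G∉Γ ∘ in-mcs)) (missing-antitone Gs)
  missing-< (there G∈Gs) □G∈Δ □G∉Γ =
    +-mono-≤-< (indicator-antitone (out ∘ Γ⊆Δ ∘ in-mcs)) (missing-< G∈Gs □G∈Δ □G∉Γ)

-- The formulas G whose boxes □G the successors built by the truth lemma for A
-- newly acquire; confining them to a finite Φ makes R conversely well-founded.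
boxable : Fm → List Fm
boxable (var _) = []
boxable top = []
boxable bot = []
boxable (A ⇒ B) = boxable A ++ boxable B
boxable (A ∨' B) = boxable A ++ boxable B
boxable (A ∧' B) = boxable A ++ boxable B
boxable (□ A) = A ∷ boxable A
boxable (A ▷ B) = neg A ∷ neg B ∷ boxable A ++ boxable B

module Canonical (lem : ExcludedMiddle) (Φ : List Fm) (Γ₀ : MCS) where

  infix 4 _≺_

  _≺_ : MCS → MCS → Set
  Γ ≺ Δ = Boxed Γ ⊆ (Δ ∋_) × Σ[ G ∈ Fm ] G ∈ Φ × Δ ∋ □ G × ¬ Γ ∋ □ G

  ≺-boxes : ∀ {Γ Δ} → Γ ≺ Δ → Boxed Γ ⊆ Boxed Δ
  ≺-boxes (Γ⊆Δ , _) = Γ⊆Δ ∘ ∋-⇒ □-4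

  ≺-trans : ∀ {Γ Δ Θ} → Γ ≺ Δ → Δ ≺ Θ → Γ ≺ Θ
  ≺-trans Γ≺Δ@(_ , G , G∈Φ , □G∈Δ , □G∉Γ) (Δ⊆Θ , _) =
    Δ⊆Θ ∘ ≺-boxes Γ≺Δ , G , G∈Φ , Δ⊆Θ (∋-⇒ □-4 □G∈Δ) , □G∉Γ

  ≺-◇ : ∀ {Γ Δ} → Γ ≺ Δ → Δ ∋ A → Γ ∋ ◇ A
  ≺-◇ {A} (Γ⊆Δ , _) A∈Δ = ∌⇒∋neg λ □¬A∈Γ → ∋neg⇒∌ (Γ⊆Δ □¬A∈Γ) A∈Δ

  ≺-missing : ∀ {Γ Δ} → Γ ≺ Δ → missing Δ Φ < missing Γ Φ
  ≺-missing Γ≺Δ@(_ , G , G∈Φ , □G∈Δ , □G∉Γ) = missing-< (≺-boxes Γ≺Δ) G∈Φ □G∈Δ □G∉Γ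

  ▷-excludes-□¬ : ∀ {Γ Δ} → Γ ≺ Δ → Γ ∋ B ▷ C → Δ ∋ B → ¬ Γ ∋ □ (neg C)
  ▷-excludes-□¬ (Γ⊆Δ , _) B▷C B∈Δ □¬C∈Γ =
    ∋neg⇒∌ (Γ⊆Δ (∋-⇒ ▷⊥⇒□¬ (▷-trans B▷C (∋-⇒ □¬⇒▷⊥ □¬C∈Γ)))) B∈Δ

  mcs : Tree → MCS
  mcs root = Γ₀
  mcs (node p Δ D t) = Δ

  Valid : Tree → Set
  Valid root = ⊤
  Valid (node p Δ D t) = Valid p × mcs p ≺ Δ × Critical D (mcs p) Δ

  valid-⊏ : ∀ {a b} → a ⊏ b → Valid b → Valid a
  valid-⊏ parent = proj₁
  valid-⊏ (ancestor a⊏p) = valid-⊏ a⊏p ∘ proj₁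

  ≺-⊏ : ∀ {a b} → a ⊏ b → Valid b → mcs a ≺ mcs b
  ≺-⊏ parent (_ , p≺Δ , _) = p≺Δ
  ≺-⊏ (ancestor a⊏p) (vp , p≺Δ , _) = ≺-trans (≺-⊏ a⊏p vp) p≺Δ

  World : Set
  World = Σ Tree Valid

  mcsʷ : World → MCS
  mcsʷ = mcs ∘ proj₁

  infix 4 _⊏ʷ_

  _⊏ʷ_ : World → World → Set
  v ⊏ʷ w = proj₁ v ⊏ proj₁ w

  data SideStep : Tree → Tree → Set where
    side-step : ∀ {a x Δ′ D t′ Δ} → x ⊏ a → node x Δ′ D t′ ⊑ a → ¬ Δ ∋ D →
                SideStep a (node x Δ D a)

  data Step (v w : World) : Set where
    down  : v ⊏ʷ w → Step v w
    aside : SideStep (proj₁ v) (proj₁ w) → Step v w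

  size-Step : ∀ {v w} → Step v w → size (proj₁ v) < size (proj₁ w)
  size-Step (down v⊏w) = size-⊏ v⊏w
  size-Step (aside (side-step {a} {x} {D = D} {Δ = Δ} _ _ _)) = size-origin x Δ D a

  size-Step⁺ : ∀ {v w} → TransClosure Step v w → size (proj₁ v) < size (proj₁ w)
  size-Step⁺ [ s ] = size-Step s
  size-Step⁺ (s ∷ ss) = <-trans (size-Step s) (size-Step⁺ ss)

  ⊏ʷ-converse-wf : WellFounded (λ w v → v ⊏ʷ w)
  ⊏ʷ-converse-wf = Subrelation.wellFounded (λ {w} v⊏w → ≺-missing (≺-⊏ v⊏w (proj₂ w)))
                     (On.wellFounded (λ w → missing (mcsʷ w) Φ) <-wellFounded)

  frame : SFrame
  frame = record
    { W = World ; R = _⊏ʷ_ ; S = TransClosure Step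
    ; R-trans = ⊏-trans ; R-cwf = ⊏ʷ-converse-wf }

  frame-J2+J5 : IsJ2+J5Frame frame
  frame-J2+J5 = record { S-trans = Plus._++_ ; R⊆S = λ v⊏w → [ down v⊏w ] }

  cone-critical : ∀ {x Δ D t n} → Valid n → node x Δ D t ⊏ n → mcs n ∋ E → ¬ mcs x ∋ ◇ E ▷ D
  cone-critical vn c⊏n E∈n = proj₂ (proj₂ (valid-⊏ c⊏n vn)) (≺-◇ (≺-⊏ c⊏n vn) E∈n)

  critical-below : ∀ {x Δ D t n} → Valid n → node x Δ D t ⊑ n → Critical D (mcs x) (mcs n)
  critical-below (_ , _ , n-crit) (inj₁ refl) = n-crit
  critical-below vn (inj₂ c⊏n) E∈n = cone-critical vn c⊏n E∈n ∘ ▷-◇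

  InCone : Tree → Fm → Tree → Set
  InCone x D n = Σ[ Δ ∈ MCS ] Σ[ t ∈ Tree ] node x Δ D t ⊑ n

  Confined : Tree → Fm → Tree → Tree → Set
  Confined x D y n = InCone x D n × (n ≡ y ⊎ ¬ mcs n ∋ D)

  -- The invariant along S-paths starting at the D-labelled child y of x.
  Guarded : Tree → Fm → Tree → Tree → Set
  Guarded x D y n = size x < size n × (x ⊏ n → Confined x D y n)

  strictly-in-cone : ∀ {x Δ D t n y} → Valid n → node x Δ D t ⊏ n → Confined x D y n
  strictly-in-cone vn c⊏n = (_ , _ , inj₂ c⊏n) , inj₂ λ D∈n → cone-critical vn c⊏n D∈n (∋-⊢ J5)

  guarded-⊏ : ∀ {x D y a b} → Valid b → Guarded x D y a → a ⊏ b → Guarded x D y b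
  guarded-⊏ {x} {D} {y} {a} {b} vb (x<a , a-cone) a⊏b = <-trans x<a (size-⊏ a⊏b) , b-cone
    where
      b-cone : x ⊏ b → Confined x D y b
      b-cone x⊏b with ⊏-linear x⊏b a⊏b
      ... | inj₁ x⊏a = strictly-in-cone vb (⊑-⊏-trans (proj₂ (proj₂ (proj₁ (a-cone x⊏a)))) a⊏b)
      ... | inj₂ (inj₁ refl) = ⊥-elim (<-irrefl refl x<a)
      ... | inj₂ (inj₂ a⊏x) = ⊥-elim (<-irrefl refl (<-trans x<a (size-⊏ a⊏x)))

  guarded-side-step : ∀ {x D y a b} → Valid b → Guarded x D y a → SideStep a b → Guarded x D y b
  guarded-side-step {x} {D} {y} vb (x<a , a-cone) (side-step {a} {x′} {D = D′} {Δ = Δ} x′⊏a c′⊑a D′∉Δ) =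
    <-trans x<a (size-origin x′ Δ D′ a) , b-cone
    where
      b-cone : x ⊏ node x′ Δ D′ a → Confined x D y (node x′ Δ D′ a)
      b-cone x⊏b with ⊏-node⁻¹ x⊏b
      ... | inj₁ refl with a-cone x′⊏a
      ... | (_ , _ , c⊑a) , _ with child-on-path-unique c⊑a c′⊑a
      ... | refl = (Δ , a , inj₁ refl) , inj₂ D′∉Δ
      b-cone x⊏b | inj₂ x⊏x′ with a-cone (⊏-trans x⊏x′ x′⊏a)
      ... | (_ , _ , c⊑a) , _ =
        strictly-in-cone vb (⊑-⊏-trans (child-on-path-below c⊑a x⊏x′ x′⊏a) parent)

  guarded-Step : ∀ {x D y v w} → Guarded x D y (proj₁ v) → Step v w → Guarded x D y (proj₁ w)
  guarded-Step {w = _ , vw} g (down v⊏w) = guarded-⊏ vw g v⊏w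
  guarded-Step {w = _ , vw} g (aside s) = guarded-side-step vw g s

  guarded-Step⁺ : ∀ {x D y v w} → Guarded x D y (proj₁ v) → TransClosure Step v w →
    Guarded x D y (proj₁ w)
  guarded-Step⁺ g [ s ] = guarded-Step g s
  guarded-Step⁺ g (s ∷ ss) = guarded-Step⁺ (guarded-Step g s) ss

  S-avoids-label : ∀ {x Δ D t} {vy : Valid (node x Δ D t)} {w} →
    TransClosure Step (node x Δ D t , vy) w → x ⊏ proj₁ w → ¬ mcsʷ w ∋ D
  S-avoids-label {x} {Δ} {D} {t} yS⁺w x⊏w
    with guarded-Step⁺ (size-parent x Δ D t , λ _ → (Δ , t , inj₁ refl) , inj₁ refl) yS⁺w
  ... | _ , w-cone with proj₂ (w-cone x⊏w)
  ... | inj₁ w≡y = ⊥-elim (<-irrefl (cong size (sym w≡y)) (size-Step⁺ yS⁺w))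
  ... | inj₂ D∉w = D∉w

  successor : ∀ {G} (w : World) (t : Tree) → Consistent (Successors (mcsʷ w) A D) →
    ⊢ (A ⇒ □ G) → G ∈ Φ → ¬ mcsʷ w ∋ □ G →
    Σ[ Δ ∈ MCS ] Δ ∋ A × Valid (node (proj₁ w) Δ D t)
  successor {G = G} (_ , vw) t cons A⇒□G G∈Φ □G∉w with critical-successor lem cons
  ... | Δ , w⊆Δ , A∈Δ , Δ-crit = Δ , A∈Δ , vw , (w⊆Δ , G , G∈Φ , ∋-⇒ A⇒□G A∈Δ , □G∉w) , Δ-crit

  □-refuter : ∀ w → ¬ mcsʷ w ∋ □ A → A ∈ Φ → Σ[ v ∈ World ] w ⊏ʷ v × mcsʷ v ∋ neg A
  □-refuter {A} w □A∉w A∈Φ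
    with successor w root (□-successors-consistent □A∉w) (⊢taut (¬ₚ ϕ ∧ₚ ψ ⇒ₚ ψ) (A ∷ □ A ∷ [])) A∈Φ □A∉w
  ... | Δ , F∈Δ , vΔ = (node (proj₁ w) Δ bot root , vΔ) , parent , ∋-proj₁ F∈Δ

  ▷-refuter : ∀ w → mcsʷ w ∋ neg (B ▷ C) → neg B ∈ Φ →
    Σ[ v ∈ World ] w ⊏ʷ v × mcsʷ v ∋ B × (∀ u → TransClosure Step v u → w ⊏ʷ u → ¬ mcsʷ u ∋ C)
  ▷-refuter {B} {C} w ¬B▷C ¬B∈Φ
    with successor w root (¬▷-successors-consistent ¬B▷C) (⊢taut (ϕ ∧ₚ ψ ⇒ₚ ψ) (B ∷ □ (neg B) ∷ []))
                   ¬B∈Φ (∋neg⇒∌ ¬B▷C ∘ □¬⇒▷)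
  ... | Δ , F∈Δ , vΔ = (node (proj₁ w) Δ C root , vΔ) , parent , ∋-proj₁ F∈Δ ,
                       λ u vS⁺u w⊏u → S-avoids-label vS⁺u w⊏u

  ▷-witness : ∀ w v → mcsʷ w ∋ B ▷ C → w ⊏ʷ v → mcsʷ v ∋ B → neg C ∈ Φ →
    Σ[ u ∈ World ] w ⊏ʷ u × TransClosure Step v u × mcsʷ u ∋ C
  ▷-witness {B} {C} w v B▷C w⊏v B∈v ¬C∈Φ with child-on-path w⊏v
  ... | _ , D , _ , c⊑v
    with successor w (proj₁ v) (▷-successors-consistent B▷C B∈v (critical-below (proj₂ v) c⊑v))
                   (⊢taut (ϕ ∧ₚ ψ ∧ₚ χ ⇒ₚ ψ) (C ∷ □ (neg C) ∷ neg D ∷ [])) ¬C∈Φ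
                   (▷-excludes-□¬ (≺-⊏ w⊏v (proj₂ v)) B▷C B∈v)
  ... | Δ , F∈Δ , vΔ = (node (proj₁ w) Δ D (proj₁ v) , vΔ) , parent ,
                       [ aside (side-step w⊏v c⊑v (∋neg⇒∌ (∋-proj₂ F∈Δ))) ] , ∋-proj₁ (∋-proj₁ F∈Δ)

  valuation : Valuation frame
  valuation p w = mcsʷ w ∋ var p

  infix 4 _⊩_

  _⊩_ : World → Fm → Set
  w ⊩ A = _,_⊩_ frame valuation w A

  Truth : Fm → Set
  Truth A = ∀ w → (w ⊩ A → mcsʷ w ∋ A) × (mcsʷ w ∋ A → w ⊩ A)

  truth-⇒ : Truth A → Truth B → Truth (A ⇒ B)
  truth-⇒ {A} {B} IHA IHB w = from-forcing , λ A⇒B∈ → proj₂ (IHB w) ∘ ∋-MP A⇒B∈ ∘ proj₁ (IHA w)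
    where
      from-forcing : w ⊩ A ⇒ B → mcsʷ w ∋ A ⇒ B
      from-forcing w⊩A⇒B with ∋-complete A
      ... | inj₁ A∈ = ∋-⇒ (⊢taut (ψ ⇒ₚ ϕ ⇒ₚ ψ) (A ∷ B ∷ [])) (proj₁ (IHB w) (w⊩A⇒B (proj₂ (IHA w) A∈)))
      ... | inj₂ ¬A∈ = ∋-⇒ (⊢taut (¬ₚ ϕ ⇒ₚ ϕ ⇒ₚ ψ) (A ∷ B ∷ [])) ¬A∈

  truth-∨ : Truth A → Truth B → Truth (A ∨' B)
  truth-∨ {A} {B} IHA IHB w = from-forcing , to-forcing
    where
      from-forcing : w ⊩ A ∨' B → mcsʷ w ∋ A ∨' B
      from-forcing (inj₁ w⊩A) = ∋-⇒ (⊢taut (ϕ ⇒ₚ ϕ ∨ₚ ψ) (A ∷ B ∷ [])) (proj₁ (IHA w) w⊩A)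
      from-forcing (inj₂ w⊩B) = ∋-⇒ (⊢taut (ψ ⇒ₚ ϕ ∨ₚ ψ) (A ∷ B ∷ [])) (proj₁ (IHB w) w⊩B)
      to-forcing : mcsʷ w ∋ A ∨' B → w ⊩ A ∨' B
      to-forcing A∨B∈ with ∋-complete A
      ... | inj₁ A∈ = inj₁ (proj₂ (IHA w) A∈)
      ... | inj₂ ¬A∈ = inj₂ (proj₂ (IHB w) (∋-⇒₂ (⊢taut (ϕ ∨ₚ ψ ⇒ₚ ¬ₚ ϕ ⇒ₚ ψ) (A ∷ B ∷ [])) A∨B∈ ¬A∈))

  truth-∧ : Truth A → Truth B → Truth (A ∧' B)
  truth-∧ {A} {B} IHA IHB w =
    (λ (w⊩A , w⊩B) → ∋-⇒₂ (⊢taut (ϕ ⇒ₚ ψ ⇒ₚ ϕ ∧ₚ ψ) (A ∷ B ∷ [])) (proj₁ (IHA w) w⊩A) (proj₁ (IHB w) w⊩B)) ,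
    (λ A∧B∈ → proj₂ (IHA w) (∋-proj₁ A∧B∈) , proj₂ (IHB w) (∋-proj₂ A∧B∈))

  truth-□ : Truth A → A ∈ Φ → Truth (□ A)
  truth-□ {A} IH A∈Φ w = from-forcing , λ □A∈ v w⊏v → proj₂ (IH v) (proj₁ (≺-⊏ w⊏v (proj₂ v)) □A∈)
    where
      from-forcing : w ⊩ □ A → mcsʷ w ∋ □ A
      from-forcing w⊩□A with lem (mcsʷ w ∋ □ A)
      ... | inj₁ □A∈ = □A∈
      ... | inj₂ □A∉ with □-refuter w □A∉ A∈Φ
      ... | v , w⊏v , ¬A∈v = ⊥-elim (∋neg⇒∌ ¬A∈v (proj₁ (IH v) (w⊩□A v w⊏v)))

  truth-▷ : Truth B → Truth C → neg B ∈ Φ → neg C ∈ Φ → Truth (B ▷ C)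
  truth-▷ {B} {C} IHB IHC ¬B∈Φ ¬C∈Φ w = from-forcing , to-forcing
    where
      from-forcing : w ⊩ B ▷ C → mcsʷ w ∋ B ▷ C
      from-forcing w⊩B▷C = [ id , ⊥-elim ∘ refuted ]′ (∋-complete (B ▷ C))
        where
          refuted : ¬ mcsʷ w ∋ neg (B ▷ C)
          refuted ¬B▷C∈ =
            let v , w⊏v , B∈v , avoids-C = ▷-refuter w ¬B▷C∈ ¬B∈Φ
                u , w⊏u , vS⁺u , u⊩C = w⊩B▷C v w⊏v (proj₂ (IHB v) B∈v)
            in avoids-C u vS⁺u w⊏u (proj₁ (IHC u) u⊩C)
      to-forcing : mcsʷ w ∋ B ▷ C → w ⊩ B ▷ C
      to-forcing B▷C∈ v w⊏v v⊩B =
        let u , w⊏u , vS⁺u , C∈u = ▷-witness w v B▷C∈ w⊏v (proj₁ (IHB v) v⊩B) ¬C∈Φ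
        in u , w⊏u , vS⁺u , proj₂ (IHC u) C∈u

  truth : ∀ A → (∀ {G} → G ∈ boxable A → G ∈ Φ) → Truth A
  truth (var p) _ w = id , id
  truth top _ w = (λ _ → ∋-⊢ (⊢taut ⊤ₚ [])) , (λ _ → tt)
  truth bot _ w = (λ ()) , ⊥-elim ∘ ∌bot
  truth (A ⇒ B) ⊆Φ = truth-⇒ (truth A (⊆Φ ∘ ∈-++⁺ˡ)) (truth B (⊆Φ ∘ ∈-++⁺ʳ (boxable A)))
  truth (A ∨' B) ⊆Φ = truth-∨ (truth A (⊆Φ ∘ ∈-++⁺ˡ)) (truth B (⊆Φ ∘ ∈-++⁺ʳ (boxable A)))
  truth (A ∧' B) ⊆Φ = truth-∧ (truth A (⊆Φ ∘ ∈-++⁺ˡ)) (truth B (⊆Φ ∘ ∈-++⁺ʳ (boxable A)))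
  truth (□ A) ⊆Φ = truth-□ (truth A (⊆Φ ∘ there)) (⊆Φ (here refl))
  truth (A ▷ B) ⊆Φ =
    truth-▷ (truth A (⊆Φ ∘ there ∘ there ∘ ∈-++⁺ˡ)) (truth B (⊆Φ ∘ there ∘ there ∘ ∈-++⁺ʳ (boxable A)))
            (⊆Φ (here refl)) (⊆Φ (there (here refl)))

-- Completeness and soundness

unprovable⇒consistent : ¬ ⊢ A → Consistent ｛ neg A ｝
unprovable⇒consistent {A} ⊬A (_ , As≡¬A , ⊢⋀As⇒⊥) =
  ⊬A (MP (⊢taut ((¬ₚ ϕ ⇒ₚ ⊥ₚ) ⇒ₚ ϕ) (A ∷ [])) (⇒-trans (⋀-replicate As≡¬A) ⊢⋀As⇒⊥))

completeness : ExcludedMiddle → ∀ A → ((F : SFrame) → IsJ2+J5Frame F → ValidIn F A) → ⊢ A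
completeness lem A valid = [ id , ⊥-elim ∘ refute ]′ (lem (⊢ A))
  where
    refute : ¬ ¬ ⊢ A
    refute ⊬A =
      let Γ₀ , ¬A∈Γ₀ = Lindenbaum.lindenbaum lem (unprovable⇒consistent ⊬A)
          open Canonical lem (boxable A) Γ₀
      in ∋neg⇒∌ (¬A∈Γ₀ refl) (proj₁ (truth A id (root , tt)) (valid frame frame-J2+J5 valuation (root , tt)))

module Soundness (lem : ExcludedMiddle) (𝔉 : SFrame) (𝔉-J2+J5 : IsJ2+J5Frame 𝔉) (V : Valuation 𝔉) where
  open SFrame 𝔉
  open IsJ2+J5Frame 𝔉-J2+J5

  infix 4 _⊩_

  _⊩_ : W → Fm → Set
  x ⊩ A = _,_⊩_ 𝔉 V x A

  atoms : W → Fm → Bool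
  atoms x A = does (decide lem (x ⊩ A))

  evalB-reflects : ∀ x A → Reflects (x ⊩ A) (evalB (atoms x) A)
  evalB-reflects x (var p) = proof (decide lem (x ⊩ var p))
  evalB-reflects x top = ofʸ tt
  evalB-reflects x bot = ofⁿ λ ()
  evalB-reflects x (A ⇒ B) = evalB-reflects x A →-reflects evalB-reflects x B
  evalB-reflects x (A ∨' B) = evalB-reflects x A ⊎-reflects evalB-reflects x B
  evalB-reflects x (A ∧' B) = evalB-reflects x A ×-reflects evalB-reflects x B
  evalB-reflects x (□ A) = proof (decide lem (x ⊩ □ A))
  evalB-reflects x (A ▷ B) = proof (decide lem (x ⊩ A ▷ B))

  tautology-forced : Tautology A → ∀ x → x ⊩ A
  tautology-forced {A} taut-A x with evalB (atoms x) A | taut-A (atoms x) | evalB-reflects x A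
  ... | .true | refl | ofʸ x⊩A = x⊩A

  löb-forced : ∀ x → x ⊩ □ (□ A ⇒ A) ⇒ □ A
  löb-forced {A} x x⊩□[□A⇒A] = λ y xRy → go y (R-cwf y) xRy
    where
      go : ∀ y → Acc (λ z y → R y z) y → R x y → y ⊩ A
      go y (acc rec) xRy = x⊩□[□A⇒A] y xRy λ z yRz → go z (rec yRz) (R-trans xRy yRz)

  J5-forced : ∀ x → x ⊩ ◇ A ▷ A
  J5-forced {A} x y xRy y⊩◇A with lem (Σ[ z ∈ W ] R y z × z ⊩ A)
  ... | inj₁ (z , yRz , z⊩A) = z , R-trans xRy yRz , R⊆S yRz , z⊩A
  ... | inj₂ no-A-successor = ⊥-elim (y⊩◇A λ z yRz z⊩A → no-A-successor (z , yRz , z⊩A))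

  sound : ⊢ A → ∀ x → x ⊩ A
  sound (taut {A} taut-A) = tautology-forced {A} taut-A
  sound K x x⊩□[A⇒B] x⊩□A y xRy = x⊩□[A⇒B] y xRy (x⊩□A y xRy)
  sound (L {A}) = löb-forced {A}
  sound J3 x (x⊩A▷C , x⊩B▷C) y xRy = [ x⊩A▷C y xRy , x⊩B▷C y xRy ]′
  sound J6 x = (λ x⊩□¬A y xRy y⊩A → ⊥-elim (x⊩□¬A y xRy y⊩A)) ,
               (λ x⊩A▷⊥ y xRy y⊩A → proj₂ (proj₂ (proj₂ (x⊩A▷⊥ y xRy y⊩A))))
  sound J2+ x (x⊩A▷B∨C , x⊩B▷C) y xRy y⊩A with x⊩A▷B∨C y xRy y⊩A
  ... | z , xRz , ySz , inj₂ z⊩C = z , xRz , ySz , z⊩C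
  ... | z , xRz , ySz , inj₁ z⊩B with x⊩B▷C z xRz z⊩B
  ... | u , xRu , zSu , u⊩C = u , xRu , S-trans ySz zSu , u⊩C
  sound (J5 {A}) = J5-forced {A}
  sound (MP ⊢A⇒B ⊢A) x = sound ⊢A⇒B x (sound ⊢A x)
  sound (Nec ⊢A) x y xRy = sound ⊢A y
  sound (R1 ⊢A⇒B) x x⊩C▷A y xRy y⊩C with x⊩C▷A y xRy y⊩C
  ... | z , xRz , ySz , z⊩A = z , xRz , ySz , sound ⊢A⇒B z z⊩A
  sound (R2 ⊢A⇒B) x x⊩B▷C y xRy y⊩A = x⊩B▷C y xRy (sound ⊢A⇒B y y⊩A)

theorem3p3 : ExcludedMiddle → (A : Fm) →
    (⊢ A → ((F : SFrame) → IsJ2+J5Frame F → ValidIn F A)) ×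
    (((F : SFrame) → IsJ2+J5Frame F → ValidIn F A) → ⊢ A)
theorem3p3 lem A = (λ ⊢A F F-J2+J5 V → Soundness.sound lem F F-J2+J5 V ⊢A) , completeness lem A
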